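{- Let $(D,\mathcal R)$ be a predicate $k$-CSP with literals and $1\le t\le k$. If $(D,\mathcal R)$ is $t$-wise independent, then it is also $t$-wise uniform.
   Context: A $k$-CSP $(D,\mathcal R)$ ($D$ finite, $\mathcal R$ a collection of relations $R\subseteq D^k$) is a predicate CSP with literals if $D$ is an abelian group and there is $Q\subseteq D^k$ with $\mathcal R=\{Q+b: b\in D^k\}$ (coordinatewise translates). A distribution on $D^k$ is $t$-wise $\nu$-independent if its marginal on every $t$-subset $T\subseteq[k]$ equals the product distribution $\nu^T$; it is $t$-wise uniform if every such marginal is uniform on $D^T$. The CSP is $t$-wise independent if there is a distribution $\nu$ on $D$ such that every $R\in\mathcal R$ supports (contains the support of) some $t$-wise $\nu$-independent distribution; it is $t$-wise uniform if every $R\in\mathcal R$ supports some $t$-wise uniform distribution.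
   Formalization: The distribution ν on D and every distribution on D^k, whether t-wise ν-independent or t-wise uniform, take values in the rationals. -}

module Defs where

open import Data.Nat as ℕ using (ℕ; zero; suc; _^_)
open import Data.Integer using (+_)
open import Data.Rational using (ℚ; 0ℚ; 1ℚ; _+_; _*_; _≤_; _/_)
open import Data.Fin using (Fin; zero; suc)
open import Data.Fin.Properties using (_≟_)
open import Data.Fin.Subset using (Subset; inside; outside; ∣_∣)
open import Data.Vec using (Vec; []; _∷_; zipWith)
open import Data.Bool using (Bool; true; false; if_then_else_; _∧_)
open import Data.Product using (Σ; _×_; ∃; ∃-syntax)
open import Relation.Nullary using (¬_)
open import Relation.Nullary.Decidable using (⌊_⌋)
open import Relation.Binary.PropositionalEquality using (_≡_)
open import Algebra.Structures using (IsAbelianGroup)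

-- A finite abelian group D, represented on the carrier Fin n
-- (every finite abelian group is isomorphic to one of this form).
record FinAbGroup (n : ℕ) : Set where
  field
    _⊕_  : Fin n → Fin n → Fin n
    o    : Fin n
    ⊝_   : Fin n → Fin n
    isAbelianGroup : IsAbelianGroup _≡_ _⊕_ o ⊝_

module _ {n : ℕ} where

  ∑D : (Fin n → ℚ) → ℚ
  ∑D f = go n f
    where
    go : (m : ℕ) → (Fin m → ℚ) → ℚ
    go zero    g = 0ℚ
    go (suc m) g = g zero + go m (λ i → g (suc i))

  ∑Dk : (k : ℕ) → (Vec (Fin n) k → ℚ) → ℚ
  ∑Dk zero    f = f []
  ∑Dk (suc k) f = ∑D (λ a → ∑Dk k (λ v → f (a ∷ v)))

  IsDistD : (Fin n → ℚ) → Set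
  IsDistD ν = (∀ a → 0ℚ ≤ ν a) × ∑D ν ≡ 1ℚ

  IsDistDk : (k : ℕ) → (Vec (Fin n) k → ℚ) → Set
  IsDistDk k μ = (∀ x → 0ℚ ≤ μ x) × ∑Dk k μ ≡ 1ℚ

  agreeOn : {k : ℕ} → Subset k → Vec (Fin n) k → Vec (Fin n) k → Bool
  agreeOn []            []       []       = true
  agreeOn (inside ∷ T)  (x ∷ xs) (y ∷ ys) = ⌊ x ≟ y ⌋ ∧ agreeOn T xs ys
  agreeOn (outside ∷ T) (x ∷ xs) (y ∷ ys) = agreeOn T xs ys

  -- marginal of μ on T, evaluated at the restriction x|_T of x to T
  marginal : (k : ℕ) → Subset k → (Vec (Fin n) k → ℚ) → Vec (Fin n) k → ℚ
  marginal k T μ x = ∑Dk k (λ y → if agreeOn T x y then μ y else 0ℚ)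

  prodOn : {k : ℕ} → Subset k → (Fin n → ℚ) → Vec (Fin n) k → ℚ
  prodOn []            ν []       = 1ℚ
  prodOn (inside ∷ T)  ν (x ∷ xs) = ν x * prodOn T ν xs
  prodOn (outside ∷ T) ν (x ∷ xs) = prodOn T ν xs

  Supports : {k : ℕ} → (Vec (Fin n) k → Set) → (Vec (Fin n) k → ℚ) → Set
  Supports R μ = ∀ x → ¬ (μ x ≡ 0ℚ) → R x

  TWiseIndep : (k t : ℕ) → (Fin n → ℚ) → (Vec (Fin n) k → ℚ) → Set
  TWiseIndep k t ν μ =
    (T : Subset k) → ∣ T ∣ ≡ t → ∀ x → marginal k T μ x ≡ prodOn T ν x

  -- μ is t-wise uniform: every t-marginal is uniform on D^T,
  -- i.e. each of its values equals 1/|D|^t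
  TWiseUniform : (k t : ℕ) → (Vec (Fin n) k → ℚ) → Set
  TWiseUniform k t μ =
    (T : Subset k) → ∣ T ∣ ≡ t → ∀ x → marginal k T μ x * (+ (n ^ t) / 1) ≡ 1ℚ

translate : {n k : ℕ} → FinAbGroup n → (Vec (Fin n) k → Set) → Vec (Fin n) k → (Vec (Fin n) k → Set)
translate G Q b x = ∃[ q ] (Q q × x ≡ zipWith (FinAbGroup._⊕_ G) q b)

-- The predicate CSP with literals (D, {Q + b : b ∈ D^k}) is t-wise independent
CSPTWiseIndependent : {n : ℕ} → FinAbGroup n → (k t : ℕ) → (Vec (Fin n) k → Set) → Set
CSPTWiseIndependent {n} G k t Q =
  ∃[ ν ] (IsDistD ν × ((b : Vec (Fin n) k) →
    ∃[ μ ] (IsDistDk k μ × Supports (translate G Q b) μ × TWiseIndep k t ν μ)))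

CSPTWiseUniform : {n : ℕ} → FinAbGroup n → (k t : ℕ) → (Vec (Fin n) k → Set) → Set
CSPTWiseUniform {n} G k t Q =
  (b : Vec (Fin n) k) →
    ∃[ μ ] (IsDistDk k μ × Supports (translate G Q b) μ × TWiseUniform k t μ)

{-# OPTIONS --safe #-}
module Submission where

-- Average the witnesses over all translations: with N = |D|^k put
--   μ x = N⁻¹ ∑_{c ∈ Dᵏ} μ_{b+c} (x + c).
-- The summand for c is supported on (Q + b + c) - c = Q + b, so μ is too. Marginals
-- commute with averaging and translation, so the marginal of μ on a t-set T at x is
-- N⁻¹ ∑_c ν^T (x + c); as c runs over Dᵏ so does x + c, hence this value does not
-- depend on x, and it equals N⁻¹ (N / |D|^t) = |D|^-t: μ is t-wise uniform.

open import Defs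
open import Data.Nat as ℕ using (ℕ; zero; suc; _^_; _≤_; NonZero)
import Data.Nat.Properties as ℕₚ
open import Data.Integer as ℤ using (+_)
import Data.Integer.Properties as ℤₚ
open import Data.Rational as ℚ
  using (ℚ; 0ℚ; 1ℚ; _+_; _*_; _/_; 1/_; toℚᵘ; Positive; NonNegative)
import Data.Rational.Properties as ℚₚ
import Data.Rational.Unnormalised as ℚᵘ
import Data.Rational.Unnormalised.Properties as ℚᵘₚ
open import Data.Fin using (Fin; zero; suc)
open import Data.Fin.Properties using (_≟_)
open import Data.Fin.Subset using (Subset; inside; outside; ∣_∣)
open import Data.Fin.Permutation using (Permutation; _⟨$⟩ʳ_; permutation)
open import Data.Vec using (Vec; []; _∷_; zipWith)
import Data.Vec.Properties as Vecₚ
open import Data.Bool using (true; false; if_then_else_; _∧_)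
open import Data.Product using (_,_; ∃-syntax; proj₁; proj₂)
open import Data.Empty using (⊥-elim)
open import Function.Bundles using (mk⇔)
open import Relation.Nullary using (¬_; yes; no)
open import Relation.Nullary.Decidable using (⌊_⌋; does; isYes≗does; does-⇔)
open import Relation.Binary.PropositionalEquality
open import Algebra.Bundles using (Group; CommutativeMonoid)
open import Algebra.Structures using (IsAbelianGroup)
open import Algebra.Properties.CommutativeMonoid.Sum ℚₚ.+-0-commutativeMonoid
  using (sum; ∑-comm; ∑-permute)
open import Algebra.Properties.CommutativeSemigroup
  (CommutativeMonoid.commutativeSemigroup ℚₚ.*-1-commutativeMonoid) using (x∙yz≈y∙xz)

fromℕ : ℕ → ℚ
fromℕ m = + m / 1

toℚᵘ-fromℕ : ∀ m → toℚᵘ (fromℕ m) ℚᵘ.≃ ℚᵘ.mkℚᵘ (+ m) 0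
toℚᵘ-fromℕ m = ℚₚ.toℚᵘ-fromℚᵘ (ℚᵘ.mkℚᵘ (+ m) 0)

fromℕ-+ : ∀ a b → fromℕ (a ℕ.+ b) ≡ fromℕ a + fromℕ b
fromℕ-+ a b = ℚₚ.toℚᵘ-injective (begin
  toℚᵘ (fromℕ (a ℕ.+ b))                 ≈⟨ toℚᵘ-fromℕ (a ℕ.+ b) ⟩
  ℚᵘ.mkℚᵘ (+ (a ℕ.+ b)) 0                ≈⟨ ℚᵘ.*≡* (cong (ℤ._* + 1) +a+b≡a*1+b*1) ⟩
  ℚᵘ.mkℚᵘ (+ a) 0 ℚᵘ.+ ℚᵘ.mkℚᵘ (+ b) 0   ≈⟨ ℚᵘₚ.+-cong (toℚᵘ-fromℕ a) (toℚᵘ-fromℕ b) ⟨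
  toℚᵘ (fromℕ a) ℚᵘ.+ toℚᵘ (fromℕ b)     ≈⟨ ℚₚ.toℚᵘ-homo-+ (fromℕ a) (fromℕ b) ⟨
  toℚᵘ (fromℕ a + fromℕ b)               ∎)
  where
  open ℚᵘₚ.≃-Reasoning
  +a+b≡a*1+b*1 : + (a ℕ.+ b) ≡ + a ℤ.* + 1 ℤ.+ + b ℤ.* + 1
  +a+b≡a*1+b*1 = trans (ℤₚ.pos-+ a b)
                       (sym (cong₂ ℤ._+_ (ℤₚ.*-identityʳ (+ a)) (ℤₚ.*-identityʳ (+ b))))

fromℕ-* : ∀ a b → fromℕ (a ℕ.* b) ≡ fromℕ a * fromℕ b
fromℕ-* a b = ℚₚ.toℚᵘ-injective (begin
  toℚᵘ (fromℕ (a ℕ.* b))                 ≈⟨ toℚᵘ-fromℕ (a ℕ.* b) ⟩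
  ℚᵘ.mkℚᵘ (+ (a ℕ.* b)) 0                ≈⟨ ℚᵘ.*≡* (cong (ℤ._* + 1) (ℤₚ.pos-* a b)) ⟩
  ℚᵘ.mkℚᵘ (+ a) 0 ℚᵘ.* ℚᵘ.mkℚᵘ (+ b) 0   ≈⟨ ℚᵘₚ.*-cong (toℚᵘ-fromℕ a) (toℚᵘ-fromℕ b) ⟨
  toℚᵘ (fromℕ a) ℚᵘ.* toℚᵘ (fromℕ b)     ≈⟨ ℚₚ.toℚᵘ-homo-* (fromℕ a) (fromℕ b) ⟨
  toℚᵘ (fromℕ a * fromℕ b)               ∎)
  where open ℚᵘₚ.≃-Reasoning

fromℕ-pos : ∀ m .{{_ : NonZero m}} → Positive (fromℕ m)
fromℕ-pos m = ℚₚ.normalize-pos m 1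

∑D≡sum : ∀ {m} (f : Fin m → ℚ) → ∑D f ≡ sum f
∑D≡sum {zero}  f = refl
∑D≡sum {suc m} f = cong (_+_ (f zero)) (∑D≡sum (λ i → f (suc i)))

∑D-cong : ∀ {m} {f g : Fin m → ℚ} → (∀ i → f i ≡ g i) → ∑D f ≡ ∑D g
∑D-cong {zero}  f≗g = refl
∑D-cong {suc m} f≗g = cong₂ _+_ (f≗g zero) (∑D-cong (λ i → f≗g (suc i)))

∑D-distribˡ : ∀ {m} r (f : Fin m → ℚ) → ∑D (λ i → r * f i) ≡ r * ∑D f
∑D-distribˡ {zero}  r f = sym (ℚₚ.*-zeroʳ r)
∑D-distribˡ {suc m} r f = trans (cong (_+_ (r * f zero)) (∑D-distribˡ r (λ i → f (suc i))))
                                (sym (ℚₚ.*-distribˡ-+ r (f zero) _))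

∑D-nonneg : ∀ {m} (f : Fin m → ℚ) → (∀ i → 0ℚ ℚ.≤ f i) → 0ℚ ℚ.≤ ∑D f
∑D-nonneg {zero}  f f≥0 = ℚₚ.≤-refl
∑D-nonneg {suc m} f f≥0 = ℚₚ.+-mono-≤ (f≥0 zero) (∑D-nonneg (λ i → f (suc i)) (λ i → f≥0 (suc i)))

∑D≢0⇒∃≢0 : ∀ {m} (f : Fin m → ℚ) → ¬ (∑D f ≡ 0ℚ) → ∃[ i ] ¬ (f i ≡ 0ℚ)
∑D≢0⇒∃≢0 {zero}  f ∑≢0 = ⊥-elim (∑≢0 refl)
∑D≢0⇒∃≢0 {suc m} f ∑≢0 with f zero ℚₚ.≟ 0ℚ
... | no  f0≢0 = zero , f0≢0
... | yes f0≡0 =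
  let i , fi≢0 = ∑D≢0⇒∃≢0 (λ i → f (suc i)) (λ ∑≡0 → ∑≢0 (cong₂ _+_ f0≡0 ∑≡0))
  in suc i , fi≢0

∑D-const : ∀ {m} r → ∑D {m} (λ _ → r) ≡ fromℕ m * r
∑D-const {zero}  r = sym (ℚₚ.*-zeroˡ r)
∑D-const {suc m} r = begin
  r + ∑D {m} (λ _ → r)    ≡⟨ cong₂ _+_ (sym (ℚₚ.*-identityˡ r)) (∑D-const {m} r) ⟩
  1ℚ * r + fromℕ m * r    ≡⟨ ℚₚ.*-distribʳ-+ r 1ℚ (fromℕ m) ⟨
  (1ℚ + fromℕ m) * r      ≡⟨ cong (_* r) (fromℕ-+ 1 m) ⟨
  fromℕ (suc m) * r       ∎
  where open ≡-Reasoning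

∑D-comm : ∀ {m p} (F : Fin m → Fin p → ℚ) →
          ∑D (λ i → ∑D (λ j → F i j)) ≡ ∑D (λ j → ∑D (λ i → F i j))
∑D-comm F = begin
  ∑D (λ i → ∑D (λ j → F i j))         ≡⟨ ∑D-cong (λ i → ∑D≡sum (F i)) ⟩
  ∑D (λ i → sum (λ j → F i j))        ≡⟨ ∑D≡sum (λ i → sum (F i)) ⟩
  sum (λ i → sum (λ j → F i j))       ≡⟨ ∑-comm F ⟩
  sum (λ j → sum (λ i → F i j))       ≡⟨ ∑D≡sum (λ j → sum (λ i → F i j)) ⟨
  ∑D (λ j → sum (λ i → F i j))        ≡⟨ ∑D-cong (λ j → ∑D≡sum (λ i → F i j)) ⟨
  ∑D (λ j → ∑D (λ i → F i j))         ∎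
  where open ≡-Reasoning

∑D-permute : ∀ {m} (f : Fin m → ℚ) (π : Permutation m m) → ∑D f ≡ ∑D (λ i → f (π ⟨$⟩ʳ i))
∑D-permute f π = trans (∑D≡sum f) (trans (∑-permute f π) (sym (∑D≡sum (λ i → f (π ⟨$⟩ʳ i)))))

module _ {n : ℕ} where

  ∑Dk-cong : ∀ k {f g : Vec (Fin n) k → ℚ} → (∀ x → f x ≡ g x) → ∑Dk k f ≡ ∑Dk k g
  ∑Dk-cong zero    f≗g = f≗g []
  ∑Dk-cong (suc k) f≗g = ∑D-cong (λ a → ∑Dk-cong k (λ v → f≗g (a ∷ v)))

  ∑Dk-distribˡ : ∀ k r (f : Vec (Fin n) k → ℚ) → ∑Dk k (λ x → r * f x) ≡ r * ∑Dk k f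
  ∑Dk-distribˡ zero    r f = refl
  ∑Dk-distribˡ (suc k) r f =
    trans (∑D-cong (λ a → ∑Dk-distribˡ k r (λ v → f (a ∷ v))))
          (∑D-distribˡ r (λ a → ∑Dk k (λ v → f (a ∷ v))))

  ∑Dk-nonneg : ∀ k (f : Vec (Fin n) k → ℚ) → (∀ x → 0ℚ ℚ.≤ f x) → 0ℚ ℚ.≤ ∑Dk k f
  ∑Dk-nonneg zero    f f≥0 = f≥0 []
  ∑Dk-nonneg (suc k) f f≥0 =
    ∑D-nonneg _ (λ a → ∑Dk-nonneg k (λ v → f (a ∷ v)) (λ v → f≥0 (a ∷ v)))

  ∑Dk≢0⇒∃≢0 : ∀ k (f : Vec (Fin n) k → ℚ) → ¬ (∑Dk k f ≡ 0ℚ) → ∃[ x ] ¬ (f x ≡ 0ℚ)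
  ∑Dk≢0⇒∃≢0 zero    f ∑≢0 = [] , ∑≢0
  ∑Dk≢0⇒∃≢0 (suc k) f ∑≢0 =
    let a , ∑a≢0 = ∑D≢0⇒∃≢0 _ ∑≢0
        v , fav≢0 = ∑Dk≢0⇒∃≢0 k (λ v → f (a ∷ v)) ∑a≢0
    in a ∷ v , fav≢0

  ∑Dk-const : ∀ k r → ∑Dk {n} k (λ _ → r) ≡ fromℕ (n ^ k) * r
  ∑Dk-const zero    r = sym (ℚₚ.*-identityˡ r)
  ∑Dk-const (suc k) r = begin
    ∑D {n} (λ _ → ∑Dk k (λ _ → r))   ≡⟨ ∑D-cong {n} (λ _ → ∑Dk-const k r) ⟩
    ∑D {n} (λ _ → fromℕ (n ^ k) * r) ≡⟨ ∑D-const {n} (fromℕ (n ^ k) * r) ⟩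
    fromℕ n * (fromℕ (n ^ k) * r)    ≡⟨ ℚₚ.*-assoc (fromℕ n) _ r ⟨
    fromℕ n * fromℕ (n ^ k) * r      ≡⟨ cong (_* r) (fromℕ-* n (n ^ k)) ⟨
    fromℕ (n ^ suc k) * r            ∎
    where open ≡-Reasoning

  ∑Dk-∑D-comm : ∀ k (F : Vec (Fin n) k → Fin n → ℚ) →
                ∑Dk k (λ v → ∑D (λ a → F v a)) ≡ ∑D (λ a → ∑Dk k (λ v → F v a))
  ∑Dk-∑D-comm zero    F = refl
  ∑Dk-∑D-comm (suc k) F = trans (∑D-cong (λ b → ∑Dk-∑D-comm k (λ v → F (b ∷ v))))
                                (∑D-comm (λ b a → ∑Dk k (λ v → F (b ∷ v) a)))

  ∑Dk-comm : ∀ k l (F : Vec (Fin n) k → Vec (Fin n) l → ℚ) →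
             ∑Dk k (λ x → ∑Dk l (λ y → F x y)) ≡ ∑Dk l (λ y → ∑Dk k (λ x → F x y))
  ∑Dk-comm zero    l F = refl
  ∑Dk-comm (suc k) l F =
    trans (∑D-cong (λ a → ∑Dk-comm k l (λ v → F (a ∷ v))))
          (sym (∑Dk-∑D-comm l (λ y a → ∑Dk k (λ v → F (a ∷ v) y))))

  -- ∑Dk j (prodOn T ν) is |D|^(j - |T|); the statement avoids the truncated subtraction.
  ∑Dk-prodOn : {ν : Fin n → ℚ} → ∑D ν ≡ 1ℚ → ∀ {j} (T : Subset j) →
               ∑Dk j (prodOn T ν) * fromℕ (n ^ ∣ T ∣) ≡ fromℕ (n ^ j)
  ∑Dk-prodOn ∑ν≡1 []                = ℚₚ.*-identityˡ 1ℚ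
  ∑Dk-prodOn {ν} ∑ν≡1 {suc j} (inside ∷ T) = begin
    ∑D (λ a → ∑Dk j (λ v → ν a * prodOn T ν v)) * fromℕ (n ^ suc ∣ T ∣)
      ≡⟨ cong₂ _*_ ∑ν×S≡S (fromℕ-* n (n ^ ∣ T ∣)) ⟩
    S * (fromℕ n * fromℕ (n ^ ∣ T ∣))  ≡⟨ x∙yz≈y∙xz S (fromℕ n) _ ⟩
    fromℕ n * (S * fromℕ (n ^ ∣ T ∣))  ≡⟨ cong (fromℕ n *_) (∑Dk-prodOn ∑ν≡1 T) ⟩
    fromℕ n * fromℕ (n ^ j)            ≡⟨ fromℕ-* n (n ^ j) ⟨
    fromℕ (n ^ suc j)                  ∎
    where
    open ≡-Reasoning
    S : ℚ
    S = ∑Dk j (prodOn T ν)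
    ∑ν×S≡S : ∑D (λ a → ∑Dk j (λ v → ν a * prodOn T ν v)) ≡ S
    ∑ν×S≡S = begin
      ∑D (λ a → ∑Dk j (λ v → ν a * prodOn T ν v))  ≡⟨ ∑D-cong (λ a → ∑Dk-distribˡ j (ν a) _) ⟩
      ∑D (λ a → ν a * S)                           ≡⟨ ∑D-cong (λ a → ℚₚ.*-comm (ν a) S) ⟩
      ∑D (λ a → S * ν a)                           ≡⟨ ∑D-distribˡ S ν ⟩
      S * ∑D ν                                     ≡⟨ cong (S *_) ∑ν≡1 ⟩
      S * 1ℚ                                       ≡⟨ ℚₚ.*-identityʳ S ⟩
      S                                            ∎
  ∑Dk-prodOn {ν} ∑ν≡1 {suc j} (outside ∷ T) = begin
    ∑D {n} (λ _ → S) * fromℕ (n ^ ∣ T ∣)  ≡⟨ cong (_* fromℕ (n ^ ∣ T ∣)) (∑D-const {n} S) ⟩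
    fromℕ n * S * fromℕ (n ^ ∣ T ∣)       ≡⟨ ℚₚ.*-assoc (fromℕ n) S _ ⟩
    fromℕ n * (S * fromℕ (n ^ ∣ T ∣))     ≡⟨ cong (fromℕ n *_) (∑Dk-prodOn ∑ν≡1 T) ⟩
    fromℕ n * fromℕ (n ^ j)               ≡⟨ fromℕ-* n (n ^ j) ⟨
    fromℕ (n ^ suc j)                     ∎
    where
    open ≡-Reasoning
    S : ℚ
    S = ∑Dk j (prodOn T ν)

  marginal-distribˡ : ∀ k (T : Subset k) r (f : Vec (Fin n) k → ℚ) x →
                      marginal k T (λ y → r * f y) x ≡ r * marginal k T f x
  marginal-distribˡ k T r f x =
    trans (∑Dk-cong k (λ y → if-distribˡ (agreeOn T x y) (f y))) (∑Dk-distribˡ k r _)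
    where
    if-distribˡ : ∀ b a → (if b then r * a else 0ℚ) ≡ r * (if b then a else 0ℚ)
    if-distribˡ true  a = refl
    if-distribˡ false a = sym (ℚₚ.*-zeroʳ r)

  marginal-∑Dk : ∀ k (T : Subset k) l (F : Vec (Fin n) l → Vec (Fin n) k → ℚ) x →
                 marginal k T (λ y → ∑Dk l (λ c → F c y)) x ≡ ∑Dk l (λ c → marginal k T (F c) x)
  marginal-∑Dk k T l F x =
    trans (∑Dk-cong k (λ y → if-∑Dk (agreeOn T x y) (λ c → F c y)))
          (∑Dk-comm k l (λ y c → if agreeOn T x y then F c y else 0ℚ))
    where
    if-∑Dk : ∀ b (g : Vec (Fin n) l → ℚ) →
             (if b then ∑Dk l g else 0ℚ) ≡ ∑Dk l (λ c → if b then g c else 0ℚ)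
    if-∑Dk true  g = refl
    if-∑Dk false g = sym (trans (∑Dk-const l 0ℚ) (ℚₚ.*-zeroʳ (fromℕ (n ^ l))))

module Translation {n : ℕ} (G : FinAbGroup n) where
  open FinAbGroup G
  open IsAbelianGroup isAbelianGroup using (isGroup; assoc; comm)

  group : Group _ _
  group = record { isGroup = isGroup }

  open Group group using (_//_)
  open import Algebra.Properties.Group group using (//-rightDividesˡ; //-rightDividesʳ; ∙-cancelʳ)

  infixl 6 _+ᵛ_
  _+ᵛ_ : ∀ {k} → Vec (Fin n) k → Vec (Fin n) k → Vec (Fin n) k
  _+ᵛ_ = zipWith _⊕_

  +ᵛ-comm : ∀ {k} (x y : Vec (Fin n) k) → x +ᵛ y ≡ y +ᵛ x
  +ᵛ-comm = Vecₚ.zipWith-comm comm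

  +ᵛ-cancelʳ : ∀ {k} (c x y : Vec (Fin n) k) → x +ᵛ c ≡ y +ᵛ c → x ≡ y
  +ᵛ-cancelʳ []       []       []       _  = refl
  +ᵛ-cancelʳ (c ∷ cs) (x ∷ xs) (y ∷ ys) eq =
    let x+c≡y+c , xs+cs≡ys+cs = Vecₚ.∷-injective eq
    in cong₂ _∷_ (∙-cancelʳ c x y x+c≡y+c) (+ᵛ-cancelʳ cs xs ys xs+cs≡ys+cs)

  translation : Fin n → Permutation n n
  translation c = permutation (_⊕ c) (_// c) (//-rightDividesˡ c) (//-rightDividesʳ c)

  ∑Dk-translate : ∀ {k} (c : Vec (Fin n) k) (f : Vec (Fin n) k → ℚ) →
                  ∑Dk k f ≡ ∑Dk k (λ x → f (x +ᵛ c))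
  ∑Dk-translate []       f = refl
  ∑Dk-translate (c ∷ cs) f =
    trans (∑D-permute _ (translation c))
          (∑D-cong (λ a → ∑Dk-translate cs (λ v → f ((a ⊕ c) ∷ v))))

  ≟-translate : ∀ a b c → ⌊ a ⊕ c ≟ b ⊕ c ⌋ ≡ ⌊ a ≟ b ⌋
  ≟-translate a b c = begin
    ⌊ a ⊕ c ≟ b ⊕ c ⌋         ≡⟨ isYes≗does (a ⊕ c ≟ b ⊕ c) ⟩
    does (a ⊕ c ≟ b ⊕ c)  ≡⟨ does-⇔ (mk⇔ (∙-cancelʳ c a b) (cong (_⊕ c))) (a ⊕ c ≟ b ⊕ c) (a ≟ b) ⟩
    does (a ≟ b)          ≡⟨ isYes≗does (a ≟ b) ⟨
    ⌊ a ≟ b ⌋                 ∎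
    where open ≡-Reasoning

  agreeOn-translate : ∀ {k} (T : Subset k) (x y c : Vec (Fin n) k) →
                      agreeOn T (x +ᵛ c) (y +ᵛ c) ≡ agreeOn T x y
  agreeOn-translate []            []       []       []       = refl
  agreeOn-translate (inside ∷ T)  (x ∷ xs) (y ∷ ys) (c ∷ cs) =
    cong₂ _∧_ (≟-translate x y c) (agreeOn-translate T xs ys cs)
  agreeOn-translate (outside ∷ T) (x ∷ xs) (y ∷ ys) (c ∷ cs) = agreeOn-translate T xs ys cs

  marginal-translate : ∀ k (T : Subset k) (f : Vec (Fin n) k → ℚ) (x c : Vec (Fin n) k) →
                       marginal k T (λ y → f (y +ᵛ c)) x ≡ marginal k T f (x +ᵛ c)
  marginal-translate k T f x c = sym (trans (∑Dk-translate c _) (∑Dk-cong k agree))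
    where
    agree : ∀ y → (if agreeOn T (x +ᵛ c) (y +ᵛ c) then f (y +ᵛ c) else 0ℚ)
                ≡ (if agreeOn T x y then f (y +ᵛ c) else 0ℚ)
    agree y = cong (if_then f (y +ᵛ c) else 0ℚ) (agreeOn-translate T x y c)

  translate-cancelʳ : ∀ {k} {Q : Vec (Fin n) k → Set} (b c x : Vec (Fin n) k) →
                      translate G Q (b +ᵛ c) (x +ᵛ c) → translate G Q b x
  translate-cancelʳ b c x (q , Qq , x+c≡q+[b+c]) =
    q , Qq , +ᵛ-cancelʳ c x (q +ᵛ b)
               (trans x+c≡q+[b+c] (sym (Vecₚ.zipWith-assoc assoc q b c)))

module Averaging {n : ℕ} .{{_ : NonZero n}} (G : FinAbGroup n) (k : ℕ)
                 (μ : Vec (Fin n) k → Vec (Fin n) k → ℚ) where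
  open Translation G

  N : ℚ
  N = fromℕ (n ^ k)

  instance
    N-positive : Positive N
    N-positive = fromℕ-pos (n ^ k) {{ℕₚ.m^n≢0 n k}}

    N-nonZero : ℚ.NonZero N
    N-nonZero = ℚₚ.pos⇒nonZero N

    1/N-nonNegative : NonNegative (1/ N)
    1/N-nonNegative = ℚₚ.pos⇒nonNeg (1/ N) {{ℚₚ.1/pos⇒pos N}}

  sumOfTranslates : Vec (Fin n) k → ℚ
  sumOfTranslates x = ∑Dk k (λ c → μ c (x +ᵛ c))

  average : Vec (Fin n) k → ℚ
  average x = 1/ N * sumOfTranslates x

  average-isDistDk : (∀ c → IsDistDk k (μ c)) → IsDistDk k average
  average-isDistDk μ-dist = average≥0 , ∑average≡1
    where
    average≥0 : ∀ x → 0ℚ ℚ.≤ average x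
    average≥0 x = subst (ℚ._≤ average x) (ℚₚ.*-zeroʳ (1/ N))
      (ℚₚ.*-monoˡ-≤-nonNeg (1/ N) (∑Dk-nonneg k _ (λ c → proj₁ (μ-dist c) (x +ᵛ c))))

    ∑average≡1 : ∑Dk k average ≡ 1ℚ
    ∑average≡1 = begin
      ∑Dk k average                                    ≡⟨ ∑Dk-distribˡ k (1/ N) sumOfTranslates ⟩
      1/ N * ∑Dk k sumOfTranslates                     ≡⟨ cong (1/ N *_) (∑Dk-comm k k _) ⟩
      1/ N * ∑Dk k (λ c → ∑Dk k (λ x → μ c (x +ᵛ c)))  ≡⟨ cong (1/ N *_) (∑Dk-cong k ∑μc≡1) ⟩
      1/ N * ∑Dk k (λ _ → 1ℚ)                          ≡⟨ cong (1/ N *_) (∑Dk-const k 1ℚ) ⟩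
      1/ N * (N * 1ℚ)                                  ≡⟨ cong (1/ N *_) (ℚₚ.*-identityʳ N) ⟩
      1/ N * N                                         ≡⟨ ℚₚ.*-inverseˡ N ⟩
      1ℚ                                               ∎
      where
      open ≡-Reasoning
      ∑μc≡1 : ∀ c → ∑Dk k (λ x → μ c (x +ᵛ c)) ≡ 1ℚ
      ∑μc≡1 c = trans (sym (∑Dk-translate c (μ c))) (proj₂ (μ-dist c))

  average-supports : ∀ {Q : Vec (Fin n) k → Set} b →
                     (∀ c → Supports (translate G Q (b +ᵛ c)) (μ c)) →
                     Supports (translate G Q b) average
  average-supports b μ-supports x average≢0 =
    let c , μc≢0 = ∑Dk≢0⇒∃≢0 k _ (λ ∑≡0 → average≢0 (trans (cong (1/ N *_) ∑≡0) (ℚₚ.*-zeroʳ (1/ N))))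
    in translate-cancelʳ b c x (μ-supports c (x +ᵛ c) μc≢0)

  average-tWiseUniform : ∀ {t ν} → IsDistD ν → (∀ c → TWiseIndep k t ν (μ c)) →
                         TWiseUniform k t average
  average-tWiseUniform {t} {ν} (_ , ∑ν≡1) μ-indep T ∣T∣≡t x = begin
    marginal k T average x * fromℕ (n ^ t)  ≡⟨ cong (_* fromℕ (n ^ t)) marginal-average ⟩
    1/ N * S * fromℕ (n ^ t)                ≡⟨ ℚₚ.*-assoc (1/ N) S _ ⟩
    1/ N * (S * fromℕ (n ^ t))              ≡⟨ cong (λ s → 1/ N * (S * fromℕ (n ^ s))) ∣T∣≡t ⟨
    1/ N * (S * fromℕ (n ^ ∣ T ∣))          ≡⟨ cong (1/ N *_) (∑Dk-prodOn ∑ν≡1 T) ⟩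
    1/ N * N                                ≡⟨ ℚₚ.*-inverseˡ N ⟩
    1ℚ                                      ∎
    where
    open ≡-Reasoning
    S : ℚ
    S = ∑Dk k (prodOn T ν)

    marginal-sumOfTranslates : marginal k T sumOfTranslates x ≡ S
    marginal-sumOfTranslates = begin
      marginal k T sumOfTranslates x
        ≡⟨ marginal-∑Dk k T k (λ c y → μ c (y +ᵛ c)) x ⟩
      ∑Dk k (λ c → marginal k T (λ y → μ c (y +ᵛ c)) x)
        ≡⟨ ∑Dk-cong k (λ c → marginal-translate k T (μ c) x c) ⟩
      ∑Dk k (λ c → marginal k T (μ c) (x +ᵛ c))
        ≡⟨ ∑Dk-cong k (λ c → μ-indep c T ∣T∣≡t (x +ᵛ c)) ⟩
      ∑Dk k (λ c → prodOn T ν (x +ᵛ c))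
        ≡⟨ ∑Dk-cong k (λ c → cong (prodOn T ν) (+ᵛ-comm x c)) ⟩
      ∑Dk k (λ c → prodOn T ν (c +ᵛ x))
        ≡⟨ ∑Dk-translate x (prodOn T ν) ⟨
      S ∎

    marginal-average : marginal k T average x ≡ 1/ N * S
    marginal-average = trans (marginal-distribˡ k T (1/ N) sumOfTranslates x)
                             (cong (1/ N *_) marginal-sumOfTranslates)

theoremG4 : (n : ℕ) (G : FinAbGroup n) (k t : ℕ) (Q : Vec (Fin n) k → Set) →
    1 ≤ t → t ≤ k → CSPTWiseIndependent G k t Q → CSPTWiseUniform G k t Q
-- For n = 0 no ν is a distribution, as ∑D ν reduces to 0ℚ.
theoremG4 zero    G k t Q _ _ (_ , (_ , ()) , _)
theoremG4 (suc m) G k t Q _ _ (ν , ν-dist , μ-family) b =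
    average
  , average-isDistDk μ-isDist
  , average-supports b μ-supports
  , average-tWiseUniform ν-dist μ-indep
  where
  open Translation G using (_+ᵛ_)

  μ : Vec (Fin (suc m)) k → Vec (Fin (suc m)) k → ℚ
  μ c = proj₁ (μ-family (b +ᵛ c))

  μ-isDist : ∀ c → IsDistDk k (μ c)
  μ-isDist c = proj₁ (proj₂ (μ-family (b +ᵛ c)))

  μ-supports : ∀ c → Supports (translate G Q (b +ᵛ c)) (μ c)
  μ-supports c = proj₁ (proj₂ (proj₂ (μ-family (b +ᵛ c))))

  μ-indep : ∀ c → TWiseIndep k t ν (μ c)
  μ-indep c = proj₂ (proj₂ (proj₂ (μ-family (b +ᵛ c))))

  open Averaging G k μ
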